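{- Let $R$ be a convergent, forward-closed and right-reduced string rewriting system over a finite alphabet $\Sigma$. Then no two distinct rules of $R$ have the same left-hand side.
   Context: A string rewriting system $R$ over $\Sigma$ is a set of rules $l \to r$ with $l, r \in \Sigma^*$, with rewrite relation $xly \to_R xry$ for $x,y\in\Sigma^*$. $R$ is convergent if it is terminating and confluent. $R$ is right-reduced if every right-hand side is irreducible (in normal form). A string $wl$ with $w\in\Sigma^*$ and $l$ a left-hand side of $R$ is a redex; a redex is innermost if no proper prefix of it is a redex. $R$ is forward-closed if every innermost redex can be reduced to its normal form in one rewrite step. -}

module Defs where

open import Data.Nat using (ℕ)
open import Data.Fin using (Fin)
open import Data.List using (List; []; _++_)
open import Data.Product using (Σ; ∃; ∃-syntax; _×_; _,_)
open import Relation.Binary.PropositionalEquality using (_≡_; _≢_)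
open import Relation.Nullary using (¬_)
open import Relation.Binary.Construct.Closure.ReflexiveTransitive using (Star)
open import Induction.WellFounded using (WellFounded)

-- A string rewriting system over an alphabet A: a (possibly infinite) set of
-- rules l → r, given as a predicate on pairs (l , r).
SRS : Set → Set₁
SRS A = List A → List A → Set

module _ {A : Set} (R : SRS A) where

  Step : List A → List A → Set
  Step u v = ∃[ x ] ∃[ y ] ∃[ l ] ∃[ r ] (R l r × u ≡ x ++ l ++ y × v ≡ x ++ r ++ y)

  Steps : List A → List A → Set
  Steps = Star Step

  Irreducible : List A → Set
  Irreducible u = ∀ v → ¬ Step u v

  Terminating : Set
  Terminating = WellFounded (λ v u → Step u v)

  Confluent : Set
  Confluent = ∀ u v w → Steps u v → Steps u w → ∃[ z ] (Steps v z × Steps w z)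

  Convergent : Set
  Convergent = Terminating × Confluent

  RightReduced : Set
  RightReduced = ∀ l r → R l r → Irreducible r

  NormalFormOf : List A → List A → Set
  NormalFormOf u v = Steps u v × Irreducible v

  Redex : List A → Set
  Redex u = ∃[ w ] ∃[ l ] ∃[ r ] (R l r × u ≡ w ++ l)

  InnermostRedex : List A → Set
  InnermostRedex u = Redex u × (∀ p s → s ≢ [] → u ≡ p ++ s → ¬ Redex p)

  ForwardClosed : Set
  ForwardClosed = ∀ u → InnermostRedex u → ∃[ v ] (Step u v × NormalFormOf u v)

-- Both right-hand sides are one-step reducts of l, so confluence joins them;
-- by right-reducedness they are irreducible and hence equal to their join.
module Submission where

open import Defs
open import Data.Nat using (ℕ)
open import Data.Fin using (Fin)
open import Data.List using (List; [])
open import Data.List.Properties using (++-identityʳ)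
open import Data.Product using (_,_)
open import Data.Empty using (⊥-elim)
open import Relation.Binary.PropositionalEquality using (_≡_; refl; sym; trans)
open import Relation.Binary.Construct.Closure.ReflexiveTransitive using (ε; _◅_)

module _ {A : Set} (R : SRS A) where

  rule⇒Step : ∀ {l r} → R l r → Step R l r
  rule⇒Step {l} {r} l→r = [] , [] , l , r , l→r , sym (++-identityʳ l) , sym (++-identityʳ r)

  Irreducible⇒Steps⇒≡ : ∀ {u v} → Irreducible R u → Steps R u v → u ≡ v
  Irreducible⇒Steps⇒≡ irr ε       = refl
  Irreducible⇒Steps⇒≡ irr (s ◅ _) = ⊥-elim (irr _ s)

  confluent⇒rightReduced⇒unique-rhs : Confluent R → RightReduced R →
    ∀ {l r r′} → R l r → R l r′ → r ≡ r′
  confluent⇒rightReduced⇒unique-rhs conf rr {l} {r} {r′} l→r l→r′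
    with conf l r r′ (rule⇒Step l→r ◅ ε) (rule⇒Step l→r′ ◅ ε)
  ... | _ , r↠z , r′↠z =
    trans (Irreducible⇒Steps⇒≡ (rr l r l→r) r↠z) (sym (Irreducible⇒Steps⇒≡ (rr l r′ l→r′) r′↠z))

corollary1 : (n : ℕ) (R : SRS (Fin n)) → Convergent R → ForwardClosed R → RightReduced R →
    ∀ (l r r′ : List (Fin n)) → R l r → R l r′ → r ≡ r′
corollary1 n R (_ , conf) _ rr l r r′ =
  confluent⇒rightReduced⇒unique-rhs R conf rr
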